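{- Let $n > t \ge \delta \ge 0$ be integers, let $X$ be a finite nonempty set, and let $a,b \in X^n$. Then there is a set $Y \subseteq X^n$ with $|Y| \le \binom{4t-\delta}{t-\delta}|X|^{t-\delta}$ such that for every $p \in X^n$ with $\mathrm{dist}(a,p) \le \min(\mathrm{dist}(a,b), 2t-\delta)$ and $\mathrm{dist}(b,p) \le 2t$, the Hamming ball $B(p,t)$ contains at least one point of $Y$.
   Context: For $p,q \in X^n$, $\mathrm{dist}(p,q)$ is the Hamming distance (number of coordinates in which they differ). $B(p,t) = \{y \in X^n : \mathrm{dist}(y,p) \le t\}$. -}

module Defs where

open import Data.Nat using (ℕ; zero; suc; _+_)
open import Data.Fin using (Fin)
open import Data.Fin.Properties using (_≟_)
open import Data.Vec using (Vec; []; _∷_)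
open import Relation.Nullary using (yes; no)

dist : ∀ {m n} → Vec (Fin m) n → Vec (Fin m) n → ℕ
dist [] [] = 0
dist (x ∷ xs) (y ∷ ys) with x ≟ y
... | yes _ = dist xs ys
... | no  _ = suc (dist xs ys)

-- Write dist a p = k + e, where k counts the coordinates where a and b agree and e those
-- where they differ.  Each coordinate counted by k, and each where a and b differ but a = p,
-- is one where b ≠ p; hence k + dist a b ≤ dist b p + e.  With dist a p ≤ dist a b this
-- gives 2k ≤ dist b p ≤ 2t, and it also forces dist a b ≤ 4t − δ.  Let Y be the set of words
-- obtained from a by overwriting t − δ of the coordinates where a and b differ, in all
-- |X|^(t − δ) ways; there are at most C(4t − δ, t − δ) |X|^(t − δ) of them.  Choosing the
-- overwritten coordinates among the e where a also differs from p, and copying p there,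
-- gives a word of Y within k + (e ∸ (t − δ)) ≤ t of p.  If dist a b < t − δ, Y = {a} works.
module Submission where

open import Defs
open import Data.Nat using (ℕ; _≤_; _<_; _*_; _^_; _∸_; _⊓_; NonZero)
open import Data.Nat.Combinatorics using (_C_)
open import Data.Fin using (Fin)
open import Data.Vec using (Vec)
open import Data.List using (List; length)
open import Data.List.Membership.Propositional using (_∈_)
open import Data.Product using (Σ; _×_; ∃)

open import Data.Nat using (zero; suc; _+_; z≤n; s≤s; _≤?_)
open import Data.Nat.Properties hiding (_≟_)
open import Data.Nat.Combinatorics using (nCk+nC[k+1]≡[n+1]C[k+1])
open import Data.Fin.Properties using (_≟_)
open import Data.Vec using ([]; _∷_)
open import Data.List using ([]; _∷_; [_]; map; _++_; allFin; cartesianProductWith)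
open import Data.List.Properties using (length-map; length-++; length-tabulate)
open import Data.List.Membership.Propositional.Properties
  using (∈-map⁺; ∈-++⁺ˡ; ∈-++⁺ʳ; ∈-allFin; ∈-cartesianProductWith⁺)
open import Data.List.Relation.Unary.Any using (here)
open import Data.Product using (_,_)
open import Data.Empty using (⊥-elim)
open import Relation.Nullary using (yes; no; ¬_)
open import Relation.Binary.PropositionalEquality using (_≡_; refl; sym; trans; cong; cong₂)

length-cartesianProductWith : ∀ {A B C : Set} (f : A → B → C) (xs : List A) (ys : List B) →
  length (cartesianProductWith f xs ys) ≡ length xs * length ys
length-cartesianProductWith f []       ys = refl
length-cartesianProductWith f (x ∷ xs) ys = begin
  length (map (f x) ys ++ cartesianProductWith f xs ys)
    ≡⟨ length-++ (map (f x) ys) ⟩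
  length (map (f x) ys) + length (cartesianProductWith f xs ys)
    ≡⟨ cong₂ _+_ (length-map (f x) ys) (length-cartesianProductWith f xs ys) ⟩
  length ys + length xs * length ys ∎
  where open Relation.Binary.PropositionalEquality.≡-Reasoning

k≤n⇒nCk>0 : ∀ {n k} → k ≤ n → 0 < n C k
k≤n⇒nCk>0 {n}     {zero}  _         = ≤-refl
k≤n⇒nCk>0 {suc n} {suc k} (s≤s k≤n) = begin-strict
  0                   <⟨ k≤n⇒nCk>0 k≤n ⟩
  n C k               ≤⟨ m≤m+n (n C k) (n C suc k) ⟩
  n C k + n C suc k   ≡⟨ nCk+nC[k+1]≡[n+1]C[k+1] n k ⟩
  suc n C suc k       ∎
  where open ≤-Reasoning

k+k≤2t⇒k≤t : ∀ {k t} → k + k ≤ 2 * t → k ≤ t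
k+k≤2t⇒k≤t {k} k+k≤2t =
  *-cancelˡ-≤ 2 (≤-trans (≤-reflexive (cong (k +_) (+-identityʳ k))) k+k≤2t)

k+[e∸r]≤t : ∀ {k e r t} → k ≤ t → k + e ≤ t + r → k + (e ∸ r) ≤ t
k+[e∸r]≤t {k} {e} {r} {t} k≤t k+e≤t+r with e ≤? r
... | yes e≤r = ≤-trans (≤-reflexive (trans (cong (k +_) (m≤n⇒m∸n≡0 e≤r)) (+-identityʳ k))) k≤t
... | no  e≰r = begin
  k + (e ∸ r)   ≡⟨ sym (+-∸-assoc k (≰⇒≥ e≰r)) ⟩
  k + e ∸ r     ≤⟨ ∸-monoˡ-≤ r k+e≤t+r ⟩
  t + r ∸ r     ≡⟨ m+n∸n≡m t r ⟩
  t             ∎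
  where open ≤-Reasoning

2t∸δ≡t+[t∸δ] : ∀ t {δ} → δ ≤ t → 2 * t ∸ δ ≡ t + (t ∸ δ)
2t∸δ≡t+[t∸δ] t {δ} δ≤t = trans (cong (λ s → t + s ∸ δ) (+-identityʳ t)) (+-∸-assoc t δ≤t)

2t+[2t∸δ]≡4t∸δ : ∀ t {δ} → δ ≤ t → 2 * t + (2 * t ∸ δ) ≡ 4 * t ∸ δ
2t+[2t∸δ]≡4t∸δ t {δ} δ≤t = begin
  2 * t + (2 * t ∸ δ) ≡⟨ +-∸-assoc (2 * t) (≤-trans δ≤t (m≤n*m t 2)) ⟨
  2 * t + 2 * t ∸ δ   ≡⟨ cong (_∸ δ) (*-distribʳ-+ t 2 2) ⟨
  4 * t ∸ δ           ∎
  where open Relation.Binary.PropositionalEquality.≡-Reasoning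

module _ {m : ℕ} where

  Word : ℕ → Set
  Word = Vec (Fin m)

  dist-∷-≡ : ∀ {n} {x y : Fin m} (xs ys : Word n) → x ≡ y → dist (x ∷ xs) (y ∷ ys) ≡ dist xs ys
  dist-∷-≡ {x = x} {y} xs ys x≡y with x ≟ y
  ... | yes _   = refl
  ... | no  x≢y = ⊥-elim (x≢y x≡y)

  dist-∷-≢ : ∀ {n} {x y : Fin m} (xs ys : Word n) → ¬ x ≡ y →
    dist (x ∷ xs) (y ∷ ys) ≡ suc (dist xs ys)
  dist-∷-≢ {x = x} {y} xs ys x≢y with x ≟ y
  ... | yes x≡y = ⊥-elim (x≢y x≡y)
  ... | no  _   = refl

  agreeDist : ∀ {n} → Word n → Word n → Word n → ℕ
  agreeDist [] [] [] = 0
  agreeDist (x ∷ xs) (y ∷ ys) (z ∷ zs) with x ≟ y | x ≟ z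
  ... | yes _ | yes _ = agreeDist xs ys zs
  ... | yes _ | no  _ = suc (agreeDist xs ys zs)
  ... | no  _ | _     = agreeDist xs ys zs

  disagreeDist : ∀ {n} → Word n → Word n → Word n → ℕ
  disagreeDist [] [] [] = 0
  disagreeDist (x ∷ xs) (y ∷ ys) (z ∷ zs) with x ≟ y | x ≟ z
  ... | no  _ | yes _ = disagreeDist xs ys zs
  ... | no  _ | no  _ = suc (disagreeDist xs ys zs)
  ... | yes _ | _     = disagreeDist xs ys zs

  dist≡agreeDist+disagreeDist : ∀ {n} (a b p : Word n) →
    dist a p ≡ agreeDist a b p + disagreeDist a b p
  dist≡agreeDist+disagreeDist [] [] [] = refl
  dist≡agreeDist+disagreeDist (x ∷ xs) (y ∷ ys) (z ∷ zs) with x ≟ y | x ≟ z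
  ... | yes _ | yes _ = dist≡agreeDist+disagreeDist xs ys zs
  ... | yes _ | no  _ = cong suc (dist≡agreeDist+disagreeDist xs ys zs)
  ... | no  _ | yes _ = dist≡agreeDist+disagreeDist xs ys zs
  ... | no  _ | no  _ = trans (cong suc (dist≡agreeDist+disagreeDist xs ys zs))
                              (sym (+-suc (agreeDist xs ys zs) _))

  disagreeDist≤dist : ∀ {n} (a b p : Word n) → disagreeDist a b p ≤ dist a b
  disagreeDist≤dist [] [] [] = z≤n
  disagreeDist≤dist (x ∷ xs) (y ∷ ys) (z ∷ zs) with x ≟ y | x ≟ z
  ... | no  _ | yes _ = m≤n⇒m≤1+n (disagreeDist≤dist xs ys zs)
  ... | no  _ | no  _ = s≤s (disagreeDist≤dist xs ys zs)
  ... | yes _ | _     = disagreeDist≤dist xs ys zs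

  agreeDist+dist≤dist+disagreeDist : ∀ {n} (a b p : Word n) →
    agreeDist a b p + dist a b ≤ dist b p + disagreeDist a b p
  agreeDist+dist≤dist+disagreeDist [] [] [] = z≤n
  agreeDist+dist≤dist+disagreeDist (x ∷ xs) (y ∷ ys) (z ∷ zs) with x ≟ y | x ≟ z | y ≟ z
  ... | yes _   | yes _   | yes _   = agreeDist+dist≤dist+disagreeDist xs ys zs
  ... | yes x≡y | yes x≡z | no  y≢z = ⊥-elim (y≢z (trans (sym x≡y) x≡z))
  ... | yes x≡y | no  x≢z | yes y≡z = ⊥-elim (x≢z (trans x≡y y≡z))
  ... | yes _   | no  _   | no  _   = s≤s (agreeDist+dist≤dist+disagreeDist xs ys zs)
  ... | no  x≢y | yes x≡z | yes y≡z = ⊥-elim (x≢y (trans x≡z (sym y≡z)))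
  ... | no  _   | yes _   | no  _   = begin
    agreeDist xs ys zs + suc (dist xs ys)         ≡⟨ +-suc _ _ ⟩
    suc (agreeDist xs ys zs + dist xs ys)         ≤⟨ s≤s (agreeDist+dist≤dist+disagreeDist xs ys zs) ⟩
    suc (dist ys zs) + disagreeDist xs ys zs      ∎
    where open ≤-Reasoning
  ... | no  _   | no  _   | yes _   = begin
    agreeDist xs ys zs + suc (dist xs ys)         ≡⟨ +-suc _ _ ⟩
    suc (agreeDist xs ys zs + dist xs ys)         ≤⟨ s≤s (agreeDist+dist≤dist+disagreeDist xs ys zs) ⟩
    suc (dist ys zs + disagreeDist xs ys zs)      ≡⟨ +-suc _ _ ⟨
    dist ys zs + suc (disagreeDist xs ys zs)      ∎
    where open ≤-Reasoning
  ... | no  _   | no  _   | no  _   = begin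
    agreeDist xs ys zs + suc (dist xs ys)         ≡⟨ +-suc _ _ ⟩
    suc (agreeDist xs ys zs + dist xs ys)         ≤⟨ s≤s (agreeDist+dist≤dist+disagreeDist xs ys zs) ⟩
    suc (dist ys zs + disagreeDist xs ys zs)      ≡⟨ +-suc _ _ ⟨
    dist ys zs + suc (disagreeDist xs ys zs)      ≤⟨ n≤1+n _ ⟩
    suc (dist ys zs + suc (disagreeDist xs ys zs)) ∎
    where open ≤-Reasoning

  dist-triangle : ∀ {n} (a b p : Word n) → dist a b ≤ dist b p + dist a p
  dist-triangle a b p = begin
    dist a b                                      ≤⟨ m≤n+m (dist a b) (agreeDist a b p) ⟩
    agreeDist a b p + dist a b                    ≤⟨ agreeDist+dist≤dist+disagreeDist a b p ⟩
    dist b p + disagreeDist a b p                 ≤⟨ +-monoʳ-≤ (dist b p) (m≤n+m _ (agreeDist a b p)) ⟩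
    dist b p + (agreeDist a b p + disagreeDist a b p) ≡⟨ cong (dist b p +_) (dist≡agreeDist+disagreeDist a b p) ⟨
    dist b p + dist a p                           ∎
    where open ≤-Reasoning

  agreeDist+agreeDist≤dist : ∀ {n} (a b p : Word n) → dist a p ≤ dist a b →
    agreeDist a b p + agreeDist a b p ≤ dist b p
  agreeDist+agreeDist≤dist a b p ap≤ab = +-cancelʳ-≤ e (k + k) (dist b p) (begin
    k + k + e          ≡⟨ +-assoc k k e ⟩
    k + (k + e)        ≡⟨ cong (k +_) (dist≡agreeDist+disagreeDist a b p) ⟨
    k + dist a p       ≤⟨ +-monoʳ-≤ k ap≤ab ⟩
    k + dist a b       ≤⟨ agreeDist+dist≤dist+disagreeDist a b p ⟩
    dist b p + e       ∎)
    where
    open ≤-Reasoning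
    k = agreeDist a b p
    e = disagreeDist a b p

  alterations : ∀ {n} → ℕ → Word n → Word n → List (Word n)
  alterations zero    a        _        = [ a ]
  alterations (suc r) []       []       = []
  alterations (suc r) (x ∷ xs) (y ∷ ys) with x ≟ y
  ... | yes _ = map (x ∷_) (alterations (suc r) xs ys)
  ... | no  _ = map (x ∷_) (alterations (suc r) xs ys)
             ++ cartesianProductWith _∷_ (allFin m) (alterations r xs ys)

  length-alterations : ∀ {n} N r (a b : Word n) → dist a b ≤ N →
    length (alterations r a b) ≤ (N C r) * m ^ r
  length-alterations N zero a b _ = ≤-reflexive (sym (+-identityʳ 1))
  length-alterations N (suc r) [] [] _ = z≤n
  length-alterations N (suc r) (x ∷ xs) (y ∷ ys) ab≤N with x ≟ y
  ... | yes _ = begin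
    length (map (x ∷_) (alterations (suc r) xs ys)) ≡⟨ length-map (x ∷_) (alterations (suc r) xs ys) ⟩
    length (alterations (suc r) xs ys)              ≤⟨ length-alterations N (suc r) xs ys ab≤N ⟩
    (N C suc r) * m ^ suc r                         ∎
    where open ≤-Reasoning
  length-alterations (suc N) (suc r) (x ∷ xs) (y ∷ ys) (s≤s ab≤N) | no _ = begin
    length (map (x ∷_) keep ++ cartesianProductWith _∷_ (allFin m) change)
      ≡⟨ length-++ (map (x ∷_) keep) ⟩
    length (map (x ∷_) keep) + length (cartesianProductWith _∷_ (allFin m) change)
      ≡⟨ cong₂ _+_ (length-map (x ∷_) keep)
                   (trans (length-cartesianProductWith _∷_ (allFin m) change)
                          (cong (_* length change) (length-tabulate {n = m} (λ i → i)))) ⟩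
    length keep + m * length change
      ≤⟨ +-mono-≤ (length-alterations N (suc r) xs ys ab≤N)
                  (*-monoʳ-≤ m (length-alterations N r xs ys ab≤N)) ⟩
    (N C suc r) * (m * m ^ r) + m * ((N C r) * m ^ r)
      ≡⟨ cong ((N C suc r) * (m * m ^ r) +_) (x∙yz≈y∙xz m (N C r) (m ^ r)) ⟩
    (N C suc r) * (m * m ^ r) + (N C r) * (m * m ^ r)
      ≡⟨ *-distribʳ-+ (m * m ^ r) (N C suc r) (N C r) ⟨
    (N C suc r + N C r) * (m * m ^ r)
      ≡⟨ cong (_* (m * m ^ r)) (trans (+-comm (N C suc r) (N C r)) (nCk+nC[k+1]≡[n+1]C[k+1] N r)) ⟩
    (suc N C suc r) * m ^ suc r ∎
    where
    open ≤-Reasoning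
    open import Algebra.Properties.CommutativeSemigroup *-commutativeSemigroup using (x∙yz≈y∙xz)
    keep = alterations (suc r) xs ys
    change = alterations r xs ys

  overwrite∈ : ∀ {n} r (x : Fin m) (xs ys : Word n) {z w} → w ∈ alterations r xs ys →
    z ∷ w ∈ map (x ∷_) (alterations (suc r) xs ys) ++ cartesianProductWith _∷_ (allFin m) (alterations r xs ys)
  overwrite∈ r x xs ys {z} w∈ = ∈-++⁺ʳ (map (x ∷_) _) (∈-cartesianProductWith⁺ _∷_ (∈-allFin z) w∈)

  -- Spend the r overwrites on coordinates where a differs from both b and p, copying p there.
  alteration-near : ∀ {n} r (a b p : Word n) → r ≤ dist a b →
    ∃ λ y → y ∈ alterations r a b × dist y p ≤ agreeDist a b p + (disagreeDist a b p ∸ r)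
  alteration-near zero a b p _ = a , here refl , ≤-reflexive (dist≡agreeDist+disagreeDist a b p)
  alteration-near (suc r) [] [] [] ()
  alteration-near (suc r) (x ∷ xs) (y ∷ ys) (z ∷ zs) r<ab with x ≟ y | x ≟ z
  ... | yes _ | yes x≡z =
    let (w , w∈ , wp≤) = alteration-near (suc r) xs ys zs r<ab
    in x ∷ w , ∈-map⁺ (x ∷_) w∈ , ≤-trans (≤-reflexive (dist-∷-≡ w zs x≡z)) wp≤
  ... | yes _ | no x≢z =
    let (w , w∈ , wp≤) = alteration-near (suc r) xs ys zs r<ab
    in x ∷ w , ∈-map⁺ (x ∷_) w∈ , ≤-trans (≤-reflexive (dist-∷-≢ w zs x≢z)) (s≤s wp≤)
  ... | no _ | no _ =
    let (w , w∈ , wp≤) = alteration-near r xs ys zs (≤-pred r<ab)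
    in z ∷ w , overwrite∈ r x xs ys w∈ , ≤-trans (≤-reflexive (dist-∷-≡ {x = z} w zs refl)) wp≤
  ... | no _ | yes x≡z with suc r ≤? dist xs ys
  ...   | yes r<xy =
    let (w , w∈ , wp≤) = alteration-near (suc r) xs ys zs r<xy
    in x ∷ w , ∈-++⁺ˡ (∈-map⁺ (x ∷_) w∈) , ≤-trans (≤-reflexive (dist-∷-≡ w zs x≡z)) wp≤
  ...   | no r≮xy =
    let (w , w∈ , wp≤) = alteration-near r xs ys zs (≤-pred r<ab)
    in z ∷ w , overwrite∈ r x xs ys w∈ ,
       ≤-trans (≤-reflexive (dist-∷-≡ {x = z} w zs refl)) (≤-trans wp≤ (+-monoʳ-≤ (agreeDist xs ys zs) e∸r≤e∸1+r))
    where
    e∸r≤e∸1+r : disagreeDist xs ys zs ∸ r ≤ disagreeDist xs ys zs ∸ suc r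
    e∸r≤e∸1+r = ≤-trans (≤-reflexive (m≤n⇒m∸n≡0 (≤-trans (disagreeDist≤dist xs ys zs) (≤-pred (≰⇒> r≮xy))))) z≤n

  module _ {n t δ} (δ≤t : δ ≤ t) (a b p : Word n)
           (ap≤ : dist a p ≤ dist a b ⊓ (2 * t ∸ δ)) (bp≤ : dist b p ≤ 2 * t) where

    dist≤4t∸δ : dist a b ≤ 4 * t ∸ δ
    dist≤4t∸δ = begin
      dist a b                ≤⟨ dist-triangle a b p ⟩
      dist b p + dist a p     ≤⟨ +-mono-≤ bp≤ (≤-trans ap≤ (m⊓n≤n _ _)) ⟩
      2 * t + (2 * t ∸ δ)     ≡⟨ 2t+[2t∸δ]≡4t∸δ t δ≤t ⟩
      4 * t ∸ δ               ∎
      where open ≤-Reasoning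

    alterations-cover : t ∸ δ ≤ dist a b → ∃ λ y → y ∈ alterations (t ∸ δ) a b × dist y p ≤ t
    alterations-cover r≤ab =
      let (y , y∈ , yp≤) = alteration-near (t ∸ δ) a b p r≤ab
      in y , y∈ , ≤-trans yp≤ (k+[e∸r]≤t k≤t k+e≤t+r)
      where
      k≤t : agreeDist a b p ≤ t
      k≤t = k+k≤2t⇒k≤t (≤-trans (agreeDist+agreeDist≤dist a b p (≤-trans ap≤ (m⊓n≤m _ _))) bp≤)
      k+e≤t+r : agreeDist a b p + disagreeDist a b p ≤ t + (t ∸ δ)
      k+e≤t+r = begin
        agreeDist a b p + disagreeDist a b p ≡⟨ dist≡agreeDist+disagreeDist a b p ⟨
        dist a p                             ≤⟨ ≤-trans ap≤ (m⊓n≤n _ _) ⟩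
        2 * t ∸ δ                            ≡⟨ 2t∸δ≡t+[t∸δ] t δ≤t ⟩
        t + (t ∸ δ)                          ∎
        where open ≤-Reasoning

lemma4p3 : (n t δ m : ℕ) → t < n → δ ≤ t → .{{_ : NonZero m}} →
    (a b : Vec (Fin m) n) →
    Σ (List (Vec (Fin m) n)) λ Y →
      (length Y ≤ ((4 * t ∸ δ) C (t ∸ δ)) * m ^ (t ∸ δ)) ×
      ((p : Vec (Fin m) n) →
        dist a p ≤ (dist a b ⊓ (2 * t ∸ δ)) →
        dist b p ≤ 2 * t →
        ∃ λ y → (y ∈ Y) × (dist y p ≤ t))
lemma4p3 n t δ m _ δ≤t a b with t ∸ δ ≤? dist a b | dist a b ≤? 4 * t ∸ δ
... | no r≰ab | _ = [ a ] , *-mono-≤ (k≤n⇒nCk>0 r≤N) (m^n>0 m (t ∸ δ)) , a-covers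
  where
  r≤N : t ∸ δ ≤ 4 * t ∸ δ
  r≤N = ∸-monoˡ-≤ δ (m≤n*m t 4)
  a-covers : ∀ p → dist a p ≤ dist a b ⊓ (2 * t ∸ δ) → dist b p ≤ 2 * t → ∃ λ y → y ∈ [ a ] × dist y p ≤ t
  a-covers p ap≤ _ = a , here refl , ≤-trans (≤-trans ap≤ (m⊓n≤m _ _)) (≤-trans (<⇒≤ (≰⇒> r≰ab)) (m∸n≤m t δ))
... | yes _    | no ab≰N = [] , z≤n , λ p ap≤ bp≤ → ⊥-elim (ab≰N (dist≤4t∸δ δ≤t a b p ap≤ bp≤))
... | yes r≤ab | yes ab≤N =
  alterations (t ∸ δ) a b , length-alterations (4 * t ∸ δ) (t ∸ δ) a b ab≤N ,
  λ p ap≤ bp≤ → alterations-cover δ≤t a b p ap≤ bp≤ r≤ab
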